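{- Let $P$ be a finite poset with $S_{\mathcal{O}(P)}(x)\le S_{\mathcal{C}(P)}(x)$. Define $\tilde\alpha_P(x)=\frac1x S^0_{\mathcal{C}(P)}(x)$, $\tilde\beta_P(x)=\frac1x S^0_{\mathcal{O}(P)}(x)$, $\tilde\gamma_P(x)=S^1_{\mathcal{O}(P)}(x)$, $\tilde\delta_P(x)=S^1_{\mathcal{C}(P)}(x)$. Then (1) $0\le x(\tilde\beta_P(x)-\tilde\alpha_P(x))\le\tilde\delta_P(x)-\tilde\gamma_P(x)$, and (2) $0\le\tilde\alpha_P(x)\le\tilde\beta_P(x)\le\tilde\gamma_P(x)\le\tilde\delta_P(x)$.
   Context: $\mathcal{O}(P)=\{x\in\mathbb{R}^P: 0\le x_p\le 1,\ x_p\le x_q \text{ if } p\le q\}$ is the order polytope and $\mathcal{C}(P)=\{x\in\mathbb{R}^P: x_p\ge 0,\ x_{p_1}+\dots+x_{p_k}\le 1 \text{ for every chain } p_1<\dots<p_k\}$ the chain polytope; both have the origin as a vertex. Faces include the empty face (dimension $-1$, considered a simplex). For a polytope $\mathcal{R}$ with the origin as a vertex, $S_{\mathcal{R}}(x)=\sum_F x^{\dim F+1}$ over all simplex faces $F$; $S^0_{\mathcal{R}}(x)$ is the same sum restricted to simplex faces containing the origin; $S^1_{\mathcal{R}}(x)$ the sum restricted to simplex faces not containing the origin (including the empty face). All polynomial inequalities are coefficient-wise. -}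

module Defs where

open import Data.Nat as ℕ using (ℕ; zero; suc)
open import Data.Bool using (Bool; true; false)
open import Data.Fin using (Fin; zero; suc)
open import Data.Vec using (Vec; lookup; replicate)
open import Data.List using (List; []; _∷_)
open import Data.Integer as ℤ using (ℤ; +_; 0ℤ)
open import Data.Product using (Σ; ∃; _×_; _,_)
open import Relation.Binary.PropositionalEquality using (_≡_)
open import Relation.Nullary using (¬_)

-- Points of {0,1}^P, P = Fin n (the ground set of the poset).

b2n : Bool → ℕ
b2n true  = 1
b2n false = 0

b2z : Bool → ℤ
b2z b = + b2n b

sumℤ : ∀ {k} → (Fin k → ℤ) → ℤ
sumℤ {zero}  f = 0ℤ
sumℤ {suc k} f = f zero ℤ.+ sumℤ (λ i → f (suc i))

dot : ∀ {n} → (Fin n → ℤ) → Vec Bool n → ℤ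
dot w v = sumℤ (λ p → w p ℤ.* b2z (lookup v p))

origin : ∀ {n} → Vec Bool n
origin {n} = replicate n false

-- Both are 0/1-polytopes (Stanley), i.e. the convex hulls of the 0/1
-- points satisfying their defining inequalities; those points are
-- exactly their vertices.

OrderVertex : ∀ {n} → (Fin n → Fin n → Set) → Vec Bool n → Set
OrderVertex _≼_ x = ∀ p q → p ≼ q → b2n (lookup x p) ℕ.≤ b2n (lookup x q)

IsChain : ∀ {n} → (Fin n → Fin n → Set) → List (Fin n) → Set
IsChain _≼_ []            = Data.Unit.⊤ where import Data.Unit
IsChain _≼_ (p ∷ [])      = Data.Unit.⊤ where import Data.Unit
IsChain _≼_ (p ∷ q ∷ ps)  = (p ≼ q) × (¬ p ≡ q) × IsChain _≼_ (q ∷ ps)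

sumAt : ∀ {n} → Vec Bool n → List (Fin n) → ℕ
sumAt x []       = 0
sumAt x (p ∷ ps) = b2n (lookup x p) ℕ.+ sumAt x ps

ChainVertex : ∀ {n} → (Fin n → Fin n → Set) → Vec Bool n → Set
ChainVertex _≼_ x = ∀ ps → IsChain _≼_ ps → sumAt x ps ℕ.≤ 1

-- Faces of a 0/1-polytope R with vertex set V, recorded through their
-- vertex sets.  An enumeration e : Fin k → Vec Bool n (injective) lists
-- the vertices of a face: there is a valid inequality w·x ≤ c for R
-- whose equality set among the vertices is exactly the image of e.
-- (w = 0, c = 1 gives the empty face, k = 0.)

IsFaceEnum : ∀ {n k} → (Vec Bool n → Set) → (Fin k → Vec Bool n) → Set
IsFaceEnum {n} {k} V e =
  (∀ i → V (e i)) ×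
  (∀ i j → e i ≡ e j → i ≡ j) ×
  Σ (Fin n → ℤ) λ w → Σ ℤ λ c →
    (∀ v → V v → dot w v ℤ.≤ c) ×
    (∀ i → dot w (e i) ≡ c) ×
    (∀ v → V v → dot w v ≡ c → ∃ λ i → e i ≡ v)

-- The face is a simplex iff its k vertices are affinely independent
-- (its dimension is then k - 1).
AffInd : ∀ {n k} → (Fin k → Vec Bool n) → Set
AffInd {n} {k} e =
  ∀ (a : Fin k → ℤ) → sumℤ a ≡ 0ℤ →
  (∀ p → sumℤ (λ i → a i ℤ.* b2z (lookup (e i) p)) ≡ 0ℤ) →
  ∀ i → a i ≡ 0ℤ

ContainsOrigin : ∀ {n k} → (Fin k → Vec Bool n) → Set
ContainsOrigin e = ∃ λ i → e i ≡ origin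

SimplexFace : ∀ {n} → (Vec Bool n → Set) → ℕ → Set
SimplexFace {n} V k = Σ (Fin k → Vec Bool n) λ e → IsFaceEnum V e × AffInd e

SimplexFace⁰ : ∀ {n} → (Vec Bool n → Set) → ℕ → Set
SimplexFace⁰ {n} V k =
  Σ (Fin k → Vec Bool n) λ e → IsFaceEnum V e × AffInd e × ContainsOrigin e

SimplexFace¹ : ∀ {n} → (Vec Bool n → Set) → ℕ → Set
SimplexFace¹ {n} V k =
  Σ (Fin k → Vec Bool n) λ e → IsFaceEnum V e × AffInd e × ¬ ContainsOrigin e

SameFace : ∀ {n k} {A : (Fin k → Vec Bool n) → Set} →
           Σ (Fin k → Vec Bool n) A → Σ (Fin k → Vec Bool n) A → Set
SameFace (e , _) (e′ , _) =
  ∀ v → ((∃ λ i → e i ≡ v) → ∃ λ j → e′ j ≡ v) ×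
        ((∃ λ j → e′ j ≡ v) → ∃ λ i → e i ≡ v)

NumFaces : ∀ {n k} {A : (Fin k → Vec Bool n) → Set} → ℕ → Set
NumFaces {n} {k} {A} m =
  Σ (Fin m → Σ (Fin k → Vec Bool n) A) λ f →
    (∀ F → ∃ λ i → SameFace (f i) F) ×
    (∀ i j → SameFace (f i) (f j) → i ≡ j)

-- Coefficient of x^k in S_R, S⁰_R, S¹_R is m.
CoeffS CoeffS⁰ CoeffS¹ : ∀ {n} → (Vec Bool n → Set) → ℕ → ℕ → Set
CoeffS  {n} V k m = NumFaces {n} {k} {λ e → IsFaceEnum V e × AffInd e} m
CoeffS⁰ {n} V k m = NumFaces {n} {k} {λ e → IsFaceEnum V e × AffInd e × ContainsOrigin e} m
CoeffS¹ {n} V k m = NumFaces {n} {k} {λ e → IsFaceEnum V e × AffInd e × ¬ ContainsOrigin e} m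

{-# OPTIONS --safe #-}
module Submission where

-- Faces of 0/1-polytopes are recorded by their vertex sets, and a vertex is a subset of P:
-- an up-set for O(P), an antichain for C(P).
--
-- A simplex face of C(P) through the origin has vertices ∅, ⁅c₁⁆, …, ⁅cⱼ⁆ for a chain
-- c₁ < … < cⱼ: the face contains every subset of its vertices, and x + y = (x ∪ y) + (x ∩ y)
-- is an affine dependence unless x and y are comparable. Replacing ⁅c⁆ by the up-set ↑ c
-- gives, injectively, a simplex face of O(P) through the origin; so [xᵏ] S⁰_C ≤ [xᵏ] S⁰_O.
--
-- Up-sets are closed under ∪ and ∩, so by the same dependence the vertices of a simplex face
-- of O(P) form a chain. Deleting the origin from such a face leaves a face, cut out by adding
-- to its normal a coordinate shared by all other vertices; so [xᵏ⁺¹] S⁰_O ≤ [xᵏ] S¹_O.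
-- The rest follows from S = S⁰ + S¹ and the hypothesis S_O ≤ S_C.
--
-- The counts of faces exist, and ≼ is decidable, only classically; as all conclusions are
-- decidable inequalities between numbers, the double-negation monad is enough.

open import Data.Bool using (true; false; _∨_; _∧_; not)
open import Data.Bool.Properties using () renaming (_≟_ to _≟ᵇ_)
open import Data.Empty using (⊥-elim)
open import Data.Fin using (Fin; zero; suc; punchIn; punchOut; splitAt; join)
open import Data.Fin.Induction using (po-wellFounded)
open import Data.Fin.Properties
  using (any?; all?; punchInᵢ≢i; punchIn-injective; punchIn-punchOut; injective⇒≤; splitAt-join; join-splitAt)
  renaming (_≟_ to _≟ᶠ_)
open import Data.Fin.Subset using (Subset; ⊥; ⁅_⁆; _∈_; _∉_; _⊆_; _∪_; _∩_; ∁)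
open import Data.Fin.Subset.Properties
  using (_∈?_; nonempty?; Empty-unique; ⊆-antisym; ⊆-trans; ∉⊥; x∈⁅x⁆; x∈⁅y⁆⇒x≡y;
         p⊆p∪q; q⊆p∪q; p∩q⊆p; p∩q⊆q; x∈p∪q⁻; x∈p∪q⁺; x∈p∩q⁻; x∈p∩q⁺)
open import Data.Integer using (ℤ; +_; 0ℤ; 1ℤ; -_; _+_; _*_; _-_; _≤_; +≤+; -≤+)
import Data.Integer.Properties as ℤP
open import Algebra.Properties.Semiring.Sum ℤP.+-*-semiring
  using (sum; sum-cong-≗; ∑-distrib-+; ∑-comm; sum-remove; *-distribˡ-sum; *-distribʳ-sum)
open import Data.Integer.Tactic.RingSolver using (solve-∀)
open import Data.List using (List; []; _∷_; cartesianProductWith)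
open import Data.List.Membership.Propositional using () renaming (_∈_ to _∈ₗ_)
open import Data.List.Membership.Propositional.Properties using (∈-cartesianProductWith⁺)
open import Data.List.Relation.Unary.All as All using (All; []; _∷_)
open import Data.List.Relation.Unary.Any using (here; there)
open import Data.Nat as ℕ using (ℕ; zero; suc; z≤n; s≤s)
import Data.Nat.Properties as ℕP
open import Data.Product using (Σ; ∃; _×_; _,_; proj₁; proj₂)
open import Data.Sum as Sum using (_⊎_; inj₁; inj₂; [_,_]′; reduce)
open import Data.Unit using (tt)
open import Data.Vec as Vec using (lookup)
open import Data.Vec.Functional as Vector using (removeAt; insertAt)
open import Data.Vec.Functional.Properties using (insertAt-lookup; insertAt-punchIn)
open import Data.Vec.Properties using (lookup-zipWith; lookup-map; lookup∘tabulate; []=⇒lookup; lookup⇒[]=)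
  renaming (≡-dec to ≡-dec-Vec)
open import Effect.Monad using (RawMonad)
open import Function using (_∘_)
open import Induction.WellFounded using (Acc; acc)
open import Level using (0ℓ)
open import Relation.Binary.PropositionalEquality
open import Relation.Binary.Structures using (IsPartialOrder)
open import Relation.Nullary using (¬_; ¬?; Dec; yes; no; does)
open import Relation.Nullary.Decidable
  using (¬¬-excluded-middle; decidable-stable; dec-true; _×-dec_; _→-dec_)
open import Relation.Nullary.Negation using (¬¬-Monad)

open import Defs

open ≡-Reasoning
open RawMonad (¬¬-Monad {a = 0ℓ}) using (pure; _>>=_)

private
  variable
    k m n : ℕ

sumℤ≡sum : (f : Fin k → ℤ) → sumℤ f ≡ sum f
sumℤ≡sum {zero}  f = refl
sumℤ≡sum {suc k} f = cong (_+_ (f zero)) (sumℤ≡sum (f ∘ suc))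

sumℤ-cong : {f g : Fin k → ℤ} → f ≗ g → sumℤ f ≡ sumℤ g
sumℤ-cong {zero}  f≗g = refl
sumℤ-cong {suc k} f≗g = cong₂ _+_ (f≗g zero) (sumℤ-cong (f≗g ∘ suc))

sumℤ-distrib-+ : (f g : Fin k → ℤ) → sumℤ (λ i → f i + g i) ≡ sumℤ f + sumℤ g
sumℤ-distrib-+ f g = begin
  sumℤ (λ i → f i + g i)  ≡⟨ sumℤ≡sum (λ i → f i + g i) ⟩
  sum (λ i → f i + g i)   ≡⟨ ∑-distrib-+ f g ⟩
  sum f + sum g           ≡⟨ cong₂ _+_ (sumℤ≡sum f) (sumℤ≡sum g) ⟨
  sumℤ f + sumℤ g         ∎

sumℤ-comm : (f : Fin m → Fin k → ℤ) →
            sumℤ (λ i → sumℤ (λ j → f i j)) ≡ sumℤ (λ j → sumℤ (λ i → f i j))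
sumℤ-comm f = begin
  sumℤ (λ i → sumℤ (f i))            ≡⟨ sumℤ≡sum (λ i → sumℤ (f i)) ⟩
  sum (λ i → sumℤ (f i))             ≡⟨ sum-cong-≗ (sumℤ≡sum ∘ f) ⟩
  sum (λ i → sum (f i))              ≡⟨ ∑-comm f ⟩
  sum (λ j → sum (λ i → f i j))      ≡⟨ sum-cong-≗ (λ j → sumℤ≡sum (λ i → f i j)) ⟨
  sum (λ j → sumℤ (λ i → f i j))     ≡⟨ sumℤ≡sum (λ j → sumℤ (λ i → f i j)) ⟨
  sumℤ (λ j → sumℤ (λ i → f i j))    ∎

*-distribˡ-sumℤ : ∀ a (f : Fin k → ℤ) → a * sumℤ f ≡ sumℤ (λ i → a * f i)
*-distribˡ-sumℤ a f = begin
  a * sumℤ f              ≡⟨ cong (a *_) (sumℤ≡sum f) ⟩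
  a * sum f               ≡⟨ *-distribˡ-sum a f ⟩
  sum (λ i → a * f i)     ≡⟨ sumℤ≡sum (λ i → a * f i) ⟨
  sumℤ (λ i → a * f i)    ∎

*-distribʳ-sumℤ : ∀ a (f : Fin k → ℤ) → sumℤ f * a ≡ sumℤ (λ i → f i * a)
*-distribʳ-sumℤ a f = begin
  sumℤ f * a              ≡⟨ cong (_* a) (sumℤ≡sum f) ⟩
  sum f * a               ≡⟨ *-distribʳ-sum a f ⟩
  sum (λ i → f i * a)     ≡⟨ sumℤ≡sum (λ i → f i * a) ⟨
  sumℤ (λ i → f i * a)    ∎

sumℤ-remove : (f : Fin (suc k) → ℤ) (i : Fin (suc k)) → sumℤ f ≡ f i + sumℤ (removeAt f i)
sumℤ-remove f i = begin
  sumℤ f                       ≡⟨ sumℤ≡sum f ⟩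
  sum f                        ≡⟨ sum-remove f ⟩
  f i + sum (removeAt f i)     ≡⟨ cong (_+_ (f i)) (sumℤ≡sum (removeAt f i)) ⟨
  f i + sumℤ (removeAt f i)    ∎

sumℤ-removeAt : (f : Fin (suc k) → ℤ) {i : Fin (suc k)} → f i ≡ 0ℤ → sumℤ f ≡ sumℤ (removeAt f i)
sumℤ-removeAt f {i} fi≡0 = begin
  sumℤ f                        ≡⟨ sumℤ-remove f i ⟩
  f i + sumℤ (removeAt f i)     ≡⟨ cong (_+ sumℤ (removeAt f i)) fi≡0 ⟩
  0ℤ + sumℤ (removeAt f i)      ≡⟨ ℤP.+-identityˡ _ ⟩
  sumℤ (removeAt f i)           ∎

sumℤ-neg : (f : Fin k → ℤ) → sumℤ (λ i → - f i) ≡ - sumℤ f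
sumℤ-neg {zero}  f = refl
sumℤ-neg {suc k} f = begin
  - f zero + sumℤ (λ i → - f (suc i))  ≡⟨ cong (_+_ (- f zero)) (sumℤ-neg (f ∘ suc)) ⟩
  - f zero + - sumℤ (f ∘ suc)          ≡⟨ ℤP.neg-distrib-+ (f zero) (sumℤ (f ∘ suc)) ⟨
  - sumℤ f                             ∎

sumℤ-zero : {f : Fin k → ℤ} → (∀ i → f i ≡ 0ℤ) → sumℤ f ≡ 0ℤ
sumℤ-zero {zero}  f≡0 = refl
sumℤ-zero {suc k} f≡0 = cong₂ _+_ (f≡0 zero) (sumℤ-zero (f≡0 ∘ suc))

sumℤ-single : {f : Fin k → ℤ} (i : Fin k) → (∀ j → j ≢ i → f j ≡ 0ℤ) → sumℤ f ≡ f i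
sumℤ-single {suc k} {f} i others = begin
  sumℤ f                       ≡⟨ sumℤ-remove f i ⟩
  f i + sumℤ (removeAt f i)    ≡⟨ cong (_+_ (f i)) (sumℤ-zero (λ j → others _ (punchInᵢ≢i i j))) ⟩
  f i + 0ℤ                     ≡⟨ ℤP.+-identityʳ (f i) ⟩
  f i                          ∎

≤-+-tightˡ : ∀ {a b c d} → a ≤ c → b ≤ d → a + b ≡ c + d → a ≡ c
≤-+-tightˡ {a} {b} {c} {d} a≤c b≤d a+b≡c+d = ℤP.≤-antisym a≤c
  (subst₂ _≤_ (cancel c d) (trans (cong (_- b) (sym a+b≡c+d)) (cancel a b))
          (ℤP.+-monoʳ-≤ (c + d) (ℤP.neg-mono-≤ b≤d)))
  where
  cancel : ∀ x y → (x + y) - y ≡ x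
  cancel = solve-∀

≤-+-tight : ∀ {a b c d} → a ≤ c → b ≤ d → a + b ≡ c + d → a ≡ c × b ≡ d
≤-+-tight {a} {b} {c} {d} a≤c b≤d a+b≡c+d =
  ≤-+-tightˡ a≤c b≤d a+b≡c+d ,
  ≤-+-tightˡ b≤d a≤c (trans (ℤP.+-comm b a) (trans a+b≡c+d (ℤP.+-comm c d)))

sumℤ-nonpos : {f : Fin k → ℤ} → (∀ i → f i ≤ 0ℤ) → sumℤ f ≤ 0ℤ
sumℤ-nonpos {zero}  f≤0 = ℤP.≤-refl
sumℤ-nonpos {suc k} f≤0 = ℤP.+-mono-≤ (f≤0 zero) (sumℤ-nonpos (f≤0 ∘ suc))

sumℤ-nonpos-≡0 : {f : Fin k → ℤ} → (∀ i → f i ≤ 0ℤ) → sumℤ f ≡ 0ℤ → ∀ i → f i ≡ 0ℤ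
sumℤ-nonpos-≡0 {suc k} f≤0 Σf≡0 zero    = proj₁ (≤-+-tight (f≤0 zero) (sumℤ-nonpos (f≤0 ∘ suc)) Σf≡0)
sumℤ-nonpos-≡0 {suc k} f≤0 Σf≡0 (suc i) =
  sumℤ-nonpos-≡0 (f≤0 ∘ suc) (proj₂ (≤-+-tight (f≤0 zero) (sumℤ-nonpos (f≤0 ∘ suc)) Σf≡0)) i

δ : Fin k → Fin k → ℤ
δ i j = b2z (does (i ≟ᶠ j))

δ-refl : (i : Fin k) → δ i i ≡ 1ℤ
δ-refl i with i ≟ᶠ i
... | yes _   = refl
... | no i≢i = ⊥-elim (i≢i refl)

δ-≢ : {i j : Fin k} → i ≢ j → δ i j ≡ 0ℤ
δ-≢ {i = i} {j} i≢j with i ≟ᶠ j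
... | yes i≡j = ⊥-elim (i≢j i≡j)
... | no _    = refl

sumℤ-δ : (i : Fin k) (f : Fin k → ℤ) → sumℤ (λ j → δ i j * f j) ≡ f i
sumℤ-δ i f = begin
  sumℤ (λ j → δ i j * f j)  ≡⟨ sumℤ-single i (λ j j≢i → trans (cong (_* f j) (δ-≢ (j≢i ∘ sym)))
                                                                (ℤP.*-zeroˡ (f j))) ⟩
  δ i i * f i               ≡⟨ cong (_* f i) (δ-refl i) ⟩
  1ℤ * f i                  ≡⟨ ℤP.*-identityˡ (f i) ⟩
  f i                       ∎

χ : Subset n → Fin n → ℤ
χ x p = b2z (lookup x p)

χ-∈ : {x : Subset n} {p : Fin n} → p ∈ x → χ x p ≡ 1ℤ
χ-∈ p∈x = cong b2z ([]=⇒lookup p∈x)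

∉⇒lookup≡false : {x : Subset n} {p : Fin n} → p ∉ x → lookup x p ≡ false
∉⇒lookup≡false {x = x} {p} p∉x with lookup x p in eq
... | true  = ⊥-elim (p∉x (lookup⇒[]= p x eq))
... | false = refl

χ-∉ : {x : Subset n} {p : Fin n} → p ∉ x → χ x p ≡ 0ℤ
χ-∉ p∉x = cong b2z (∉⇒lookup≡false p∉x)

χ-⊥ : (p : Fin n) → χ ⊥ p ≡ 0ℤ
χ-⊥ p = χ-∉ {x = ⊥} {p} ∉⊥

b2z-∨∧ : ∀ a b → b2z (a ∨ b) + b2z (a ∧ b) ≡ b2z a + b2z b
b2z-∨∧ false false = refl
b2z-∨∧ false true  = refl
b2z-∨∧ true  false = refl
b2z-∨∧ true  true  = refl

χ-∪∩ : (x y : Subset n) (p : Fin n) → χ (x ∪ y) p + χ (x ∩ y) p ≡ χ x p + χ y p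
χ-∪∩ x y p rewrite lookup-zipWith _∨_ p x y | lookup-zipWith _∧_ p x y = b2z-∨∧ (lookup x p) (lookup y p)

b2z-∧-not : ∀ a b → (b ≡ true → a ≡ true) → b2z a ≡ b2z b + b2z (a ∧ not b)
b2z-∧-not false false _   = refl
b2z-∧-not false true  b⇒a with b⇒a refl
... | ()
b2z-∧-not true  false _   = refl
b2z-∧-not true  true  _   = refl

χ-∩∁ : {x y : Subset n} → y ⊆ x → (p : Fin n) → χ x p ≡ χ y p + χ (x ∩ ∁ y) p
χ-∩∁ {x = x} {y} y⊆x p rewrite lookup-zipWith _∧_ p x (∁ y) | lookup-map p not y =
  b2z-∧-not (lookup x p) (lookup y p) (λ yp → []=⇒lookup (y⊆x (lookup⇒[]= p y yp)))

𝟙 : {P : Set} → Dec P → ℤ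
𝟙 d = b2z (does d)

𝟙*-nonpos : {P : Set} (d : Dec P) {t : ℤ} → (P → t ≤ 0ℤ) → 𝟙 d * t ≤ 0ℤ
𝟙*-nonpos (yes p) {t} t≤0 = subst (_≤ 0ℤ) (sym (ℤP.*-identityˡ t)) (t≤0 p)
𝟙*-nonpos (no _)  _       = +≤+ z≤n

𝟙*-≡0⁻ : {P : Set} (d : Dec P) {t : ℤ} → 𝟙 d * t ≡ 0ℤ → P → t ≡ 0ℤ
𝟙*-≡0⁻ (yes _) {t} 𝟙t≡0 _ = trans (sym (ℤP.*-identityˡ t)) 𝟙t≡0
𝟙*-≡0⁻ (no ¬p) _ p = ⊥-elim (¬p p)

𝟙*-≡0⁺ : {P : Set} (d : Dec P) {t : ℤ} → (P → t ≡ 0ℤ) → 𝟙 d * t ≡ 0ℤ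
𝟙*-≡0⁺ (yes p) {t} t≡0 = trans (ℤP.*-identityˡ t) (t≡0 p)
𝟙*-≡0⁺ (no _)  _       = refl

b2z-sub-nonpos : ∀ a b → (a ≡ true → b ≡ true) → b2z a - b2z b ≤ 0ℤ
b2z-sub-nonpos false false _ = +≤+ z≤n
b2z-sub-nonpos false true  _ = -≤+
b2z-sub-nonpos true  true  _ = +≤+ z≤n
b2z-sub-nonpos true  false a⇒b with a⇒b refl
... | ()

b2z-sub-≡0⁻ : ∀ a b → b2z a - b2z b ≡ 0ℤ → b ≡ true → a ≡ true
b2z-sub-≡0⁻ true true _ _ = refl

b2z-sub-≡0⁺ : ∀ a b → (a ≡ true → b ≡ true) → (b ≡ true → a ≡ true) → b2z a - b2z b ≡ 0ℤ
b2z-sub-≡0⁺ false false _   _   = refl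
b2z-sub-≡0⁺ true  true  _   _   = refl
b2z-sub-≡0⁺ true  false a⇒b _   with a⇒b refl
... | ()
b2z-sub-≡0⁺ false true  _   b⇒a with b⇒a refl
... | ()

neg-b2z-nonpos : ∀ a → - b2z a ≤ 0ℤ
neg-b2z-nonpos false = +≤+ z≤n
neg-b2z-nonpos true  = -≤+

neg-b2z-≡0⁻ : ∀ a → - b2z a ≡ 0ℤ → a ≢ true
neg-b2z-≡0⁻ false _ ()

∈-tabulate⁻ : {P : Fin n → Set} (P? : ∀ q → Dec (P q)) {q : Fin n} → q ∈ Vec.tabulate (does ∘ P?) → P q
∈-tabulate⁻ P? {q} q∈ with P? q | trans (sym (lookup∘tabulate (does ∘ P?) q)) ([]=⇒lookup q∈)
... | yes Pq | _ = Pq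

∈-tabulate⁺ : {P : Fin n → Set} (P? : ∀ q → Dec (P q)) {q : Fin n} → P q → q ∈ Vec.tabulate (does ∘ P?)
∈-tabulate⁺ P? {q} Pq = lookup⇒[]= q _ (trans (lookup∘tabulate (does ∘ P?) q) (dec-true (P? q) Pq))

dot-+ : (w w′ : Fin n → ℤ) (x : Subset n) → dot (λ p → w p + w′ p) x ≡ dot w x + dot w′ x
dot-+ w w′ x = trans (sumℤ-cong (λ p → ℤP.*-distribʳ-+ (χ x p) (w p) (w′ p)))
                     (sumℤ-distrib-+ (λ p → w p * χ x p) (λ p → w′ p * χ x p))

dot-neg : (w : Fin n → ℤ) (x : Subset n) → dot (λ p → - w p) x ≡ - dot w x
dot-neg w x = trans (sumℤ-cong (λ p → sym (ℤP.neg-distribˡ-* (w p) (χ x p)))) (sumℤ-neg (λ p → w p * χ x p))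

dot-* : ∀ a (w : Fin n → ℤ) (x : Subset n) → dot (λ p → a * w p) x ≡ a * dot w x
dot-* a w x = trans (sumℤ-cong (λ p → ℤP.*-assoc a (w p) (χ x p))) (sym (*-distribˡ-sumℤ a (λ p → w p * χ x p)))

dot-sumℤ : (w : Fin k → Fin n → ℤ) (x : Subset n) →
           dot (λ p → sumℤ (λ i → w i p)) x ≡ sumℤ (λ i → dot (w i) x)
dot-sumℤ w x = trans (sumℤ-cong (λ p → *-distribʳ-sumℤ (χ x p) (λ i → w i p))) (sumℤ-comm (λ p i → w i p * χ x p))

dot-combination : (a : Fin k → ℤ) (w : Fin k → Fin n → ℤ) (x : Subset n) →
                  dot (λ p → sumℤ (λ i → a i * w i p)) x ≡ sumℤ (λ i → a i * dot (w i) x)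
dot-combination a w x = trans (dot-sumℤ (λ i p → a i * w i p) x) (sumℤ-cong (λ i → dot-* (a i) (w i) x))

dot-δ : (p : Fin n) (x : Subset n) → dot (δ p) x ≡ χ x p
dot-δ p x = sumℤ-δ p (χ x)

dot-neg-δ : (q : Fin n) (x : Subset n) → dot (λ r → - δ q r) x ≡ - χ x q
dot-neg-δ q x = trans (dot-neg (δ q) x) (cong -_ (dot-δ q x))

dot-δ-δ : (p q : Fin n) (x : Subset n) → dot (λ r → δ p r - δ q r) x ≡ χ x p - χ x q
dot-δ-δ p q x = begin
  dot (λ r → δ p r - δ q r) x           ≡⟨ dot-+ (δ p) (λ r → - δ q r) x ⟩
  dot (δ p) x + dot (λ r → - δ q r) x   ≡⟨ cong₂ _+_ (dot-δ p x) (dot-neg-δ q x) ⟩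
  χ x p - χ x q                         ∎

dot-⊥ : (w : Fin n → ℤ) → dot w ⊥ ≡ 0ℤ
dot-⊥ w = sumℤ-zero (λ p → trans (cong (w p *_) (χ-⊥ p)) (ℤP.*-zeroʳ (w p)))

dot-∪∩ : (w : Fin n → ℤ) (x y : Subset n) → dot w (x ∪ y) + dot w (x ∩ y) ≡ dot w x + dot w y
dot-∪∩ w x y = begin
  dot w (x ∪ y) + dot w (x ∩ y)
    ≡⟨ sumℤ-distrib-+ (λ p → w p * χ (x ∪ y) p) (λ p → w p * χ (x ∩ y) p) ⟨
  sumℤ (λ p → w p * χ (x ∪ y) p + w p * χ (x ∩ y) p)
    ≡⟨ sumℤ-cong pointwise ⟩
  sumℤ (λ p → w p * χ x p + w p * χ y p)
    ≡⟨ sumℤ-distrib-+ (λ p → w p * χ x p) (λ p → w p * χ y p) ⟩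
  dot w x + dot w y ∎
  where
  pointwise : ∀ p → w p * χ (x ∪ y) p + w p * χ (x ∩ y) p ≡ w p * χ x p + w p * χ y p
  pointwise p = begin
    w p * χ (x ∪ y) p + w p * χ (x ∩ y) p  ≡⟨ ℤP.*-distribˡ-+ (w p) _ _ ⟨
    w p * (χ (x ∪ y) p + χ (x ∩ y) p)      ≡⟨ cong (w p *_) (χ-∪∩ x y p) ⟩
    w p * (χ x p + χ y p)                  ≡⟨ ℤP.*-distribˡ-+ (w p) _ _ ⟩
    w p * χ x p + w p * χ y p              ∎

dot-∩∁ : (w : Fin n → ℤ) {x y : Subset n} → y ⊆ x → dot w x ≡ dot w y + dot w (x ∩ ∁ y)
dot-∩∁ w {x} {y} y⊆x = begin
  dot w x
    ≡⟨ sumℤ-cong pointwise ⟩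
  sumℤ (λ p → w p * χ y p + w p * χ (x ∩ ∁ y) p)
    ≡⟨ sumℤ-distrib-+ (λ p → w p * χ y p) (λ p → w p * χ (x ∩ ∁ y) p) ⟩
  dot w y + dot w (x ∩ ∁ y) ∎
  where
  pointwise : ∀ p → w p * χ x p ≡ w p * χ y p + w p * χ (x ∩ ∁ y) p
  pointwise p = trans (cong (w p *_) (χ-∩∁ y⊆x p)) (ℤP.*-distribˡ-+ (w p) _ _)

-- Affine independence

Image : (Fin k → Subset n) → Subset n → Set
Image e v = ∃ λ i → e i ≡ v

sumℤ-δ₄ : (i j i′ j′ : Fin k) (f : Fin k → ℤ) →
          sumℤ (λ t → ((δ i t + δ j t) - (δ i′ t + δ j′ t)) * f t) ≡ (f i + f j) - (f i′ + f j′)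
sumℤ-δ₄ i j i′ j′ f = begin
  sumℤ (λ t → ((δ i t + δ j t) - (δ i′ t + δ j′ t)) * f t)
    ≡⟨ sumℤ-cong (λ t → expand (δ i t) (δ j t) (δ i′ t) (δ j′ t) (f t)) ⟩
  sumℤ (λ t → (δ i t * f t + δ j t * f t) + - (δ i′ t * f t + δ j′ t * f t))
    ≡⟨ sumℤ-distrib-+ (λ t → δ i t * f t + δ j t * f t) (λ t → - (δ i′ t * f t + δ j′ t * f t)) ⟩
  sumℤ (λ t → δ i t * f t + δ j t * f t) + sumℤ (λ t → - (δ i′ t * f t + δ j′ t * f t))
    ≡⟨ cong₂ _+_ (sumℤ-distrib-+ (λ t → δ i t * f t) (λ t → δ j t * f t))
                 (trans (sumℤ-neg (λ t → δ i′ t * f t + δ j′ t * f t))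
                        (cong -_ (sumℤ-distrib-+ (λ t → δ i′ t * f t) (λ t → δ j′ t * f t)))) ⟩
  (sumℤ (λ t → δ i t * f t) + sumℤ (λ t → δ j t * f t)) -
  (sumℤ (λ t → δ i′ t * f t) + sumℤ (λ t → δ j′ t * f t))
    ≡⟨ cong₂ _-_ (cong₂ _+_ (sumℤ-δ i f) (sumℤ-δ j f)) (cong₂ _+_ (sumℤ-δ i′ f) (sumℤ-δ j′ f)) ⟩
  (f i + f j) - (f i′ + f j′) ∎
  where
  expand : ∀ a b c d x → ((a + b) - (c + d)) * x ≡ (a * x + b * x) + - (c * x + d * x)
  expand = solve-∀

-- The coefficient of e i in e i + e j − e i′ − e j′ vanishes only if i ∈ {i′, j′}.
AffInd-exchange : {e : Fin k → Subset n} → AffInd e → {i j i′ j′ : Fin k} →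
                  (∀ p → χ (e i) p + χ (e j) p ≡ χ (e i′) p + χ (e j′) p) → i ≡ i′ ⊎ i ≡ j′
AffInd-exchange {e = e} ind {i} {j} {i′} {j′} e+e≡e+e with i ≟ᶠ i′ | i ≟ᶠ j′
... | yes i≡i′ | _        = inj₁ i≡i′
... | no _     | yes i≡j′ = inj₂ i≡j′
... | no i≢i′  | no i≢j′  = ⊥-elim (coefficient≢0 (does (j ≟ᶠ i)) (begin
  (1ℤ + δ j i) - (0ℤ + 0ℤ)
    ≡⟨ cong₂ (λ u v → (u + δ j i) - v) (δ-refl i) (cong₂ _+_ (δ-≢ (i≢i′ ∘ sym)) (δ-≢ (i≢j′ ∘ sym))) ⟨
  a i
    ≡⟨ ind a Σa≡0 Σae≡0 i ⟩
  0ℤ ∎))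
  where
  a : Fin _ → ℤ
  a t = (δ i t + δ j t) - (δ i′ t + δ j′ t)
  Σa≡0 : sumℤ a ≡ 0ℤ
  Σa≡0 = trans (sumℤ-cong (λ t → sym (ℤP.*-identityʳ (a t)))) (sumℤ-δ₄ i j i′ j′ (λ _ → 1ℤ))
  Σae≡0 : ∀ p → sumℤ (λ t → a t * χ (e t) p) ≡ 0ℤ
  Σae≡0 p = begin
    sumℤ (λ t → a t * χ (e t) p)                     ≡⟨ sumℤ-δ₄ i j i′ j′ (λ t → χ (e t) p) ⟩
    (χ (e i) p + χ (e j) p) - (χ (e i′) p + χ (e j′) p) ≡⟨ cong (_- (χ (e i′) p + χ (e j′) p)) (e+e≡e+e p) ⟩
    (χ (e i′) p + χ (e j′) p) - (χ (e i′) p + χ (e j′) p) ≡⟨ ℤP.+-inverseʳ (χ (e i′) p + χ (e j′) p) ⟩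
    0ℤ                                                 ∎
  coefficient≢0 : ∀ b → (1ℤ + b2z b) - (0ℤ + 0ℤ) ≢ 0ℤ
  coefficient≢0 false ()
  coefficient≢0 true  ()

AffInd-comparable : {e : Fin k → Subset n} → AffInd e → {x y : Subset n} →
                    Image e x → Image e y → Image e (x ∪ y) → Image e (x ∩ y) → y ⊆ x ⊎ x ⊆ y
AffInd-comparable {e = e} ind {x} {y} (i , ei≡x) (j , ej≡y) (i∪j , e∪) (i∩j , e∩) =
  comparable (AffInd-exchange {e = e} ind modular)
  where
  modular : ∀ p → χ (e i) p + χ (e j) p ≡ χ (e i∪j) p + χ (e i∩j) p
  modular p = begin
    χ (e i) p + χ (e j) p           ≡⟨ cong₂ (λ u v → χ u p + χ v p) ei≡x ej≡y ⟩
    χ x p + χ y p                   ≡⟨ χ-∪∩ x y p ⟨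
    χ (x ∪ y) p + χ (x ∩ y) p       ≡⟨ cong₂ (λ u v → χ u p + χ v p) e∪ e∩ ⟨
    χ (e i∪j) p + χ (e i∩j) p       ∎
  comparable : i ≡ i∪j ⊎ i ≡ i∩j → y ⊆ x ⊎ x ⊆ y
  comparable (inj₁ refl) = inj₁ (subst (y ⊆_) (trans (sym e∪) ei≡x) (q⊆p∪q x y))
  comparable (inj₂ refl) = inj₂ (subst (_⊆ y) (trans (sym e∩) ei≡x) (p∩q⊆q x y))

AffInd-removeAt : {e : Fin (suc k) → Subset n} → AffInd e → (i : Fin (suc k)) → AffInd (removeAt e i)
AffInd-removeAt {e = e} ind i a Σa≡0 Σae≡0 j = begin
  a j                  ≡⟨ insertAt-punchIn a i 0ℤ j ⟨
  a′ (punchIn i j)     ≡⟨ ind a′ Σa′≡0 Σa′e≡0 (punchIn i j) ⟩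
  0ℤ                   ∎
  where
  a′ : Fin _ → ℤ
  a′ = insertAt a i 0ℤ
  Σa′≡0 : sumℤ a′ ≡ 0ℤ
  Σa′≡0 = trans (sumℤ-removeAt a′ (insertAt-lookup a i 0ℤ))
                (trans (sumℤ-cong (insertAt-punchIn a i 0ℤ)) Σa≡0)
  Σa′e≡0 : ∀ p → sumℤ (λ t → a′ t * χ (e t) p) ≡ 0ℤ
  Σa′e≡0 p = trans (sumℤ-removeAt (λ t → a′ t * χ (e t) p) (cong (_* χ (e i) p) (insertAt-lookup a i 0ℤ)))
                   (trans (sumℤ-cong (λ j → cong (_* χ (e (punchIn i j)) p) (insertAt-punchIn a i 0ℤ j))) (Σae≡0 p))

-- SameFace x y unfolds to SameImage (proj₁ x) (proj₁ y).
SameImage : (Fin k → Subset n) → (Fin k → Subset n) → Set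
SameImage e e′ = ∀ v → (Image e v → Image e′ v) × (Image e′ v → Image e v)

SameImage-sym : {e e′ : Fin k → Subset n} → SameImage e e′ → SameImage e′ e
SameImage-sym e≈e′ v = proj₂ (e≈e′ v) , proj₁ (e≈e′ v)

SameImage-trans : {e e′ e″ : Fin k → Subset n} → SameImage e e′ → SameImage e′ e″ → SameImage e e″
SameImage-trans e≈e′ e′≈e″ v =
  proj₁ (e′≈e″ v) ∘ proj₁ (e≈e′ v) , proj₂ (e≈e′ v) ∘ proj₂ (e′≈e″ v)

SameImage-≗ : {e e′ : Fin k → Subset n} → e ≗ e′ → SameImage e e′
SameImage-≗ e≗e′ v =
  (λ (i , ei≡v) → i , trans (sym (e≗e′ i)) ei≡v) , (λ (i , e′i≡v) → i , trans (e≗e′ i) e′i≡v)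

SameImage-∘⁻ : {e e′ : Fin k → Subset n} (f : Subset n → Subset n) →
               (∀ i j → f (e i) ≡ f (e′ j) → e i ≡ e′ j) → SameImage (f ∘ e) (f ∘ e′) → SameImage e e′
SameImage-∘⁻ f f-inj same v =
  (λ (i , ei≡v) → let (j , fe′j≡fv) = proj₁ (same (f v)) (i , cong f ei≡v) in
                  j , trans (sym (f-inj i j (trans (cong f ei≡v) (sym fe′j≡fv)))) ei≡v) ,
  (λ (j , e′j≡v) → let (i , fei≡fv) = proj₂ (same (f v)) (j , cong f e′j≡v) in
                   i , trans (f-inj i j (trans fei≡fv (sym (cong f e′j≡v)))) e′j≡v)

Image-removeAt : (e : Fin (suc k) → Subset n) (i : Fin (suc k)) {v : Subset n} →
                 Image e v → e i ≡ v ⊎ Image (removeAt e i) v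
Image-removeAt e i (j , ej≡v) with i ≟ᶠ j
... | yes refl = inj₁ ej≡v
... | no i≢j   = inj₂ (punchOut i≢j , trans (cong e (punchIn-punchOut i≢j)) ej≡v)

SameImage-removeAt⁻ : {e e′ : Fin (suc k) → Subset n} {i i′ : Fin (suc k)} → e i ≡ e′ i′ →
                      SameImage (removeAt e i) (removeAt e′ i′) → SameImage e e′
SameImage-removeAt⁻ {e = e} {e′} {i} {i′} ei≡e′i′ same v =
  extend e e′ i i′ ei≡e′i′ (proj₁ (same v)) , extend e′ e i′ i (sym ei≡e′i′) (proj₂ (same v))
  where
  extend : (e e′ : Fin _ → Subset _) (i i′ : Fin _) → e i ≡ e′ i′ →
           (Image (removeAt e i) v → Image (removeAt e′ i′) v) → Image e v → Image e′ v
  extend e e′ i i′ ei≡e′i′ forward im with Image-removeAt e i im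
  ... | inj₁ ei≡v = i′ , trans (sym ei≡e′i′) ei≡v
  ... | inj₂ im′  = let (j , e′j≡v) = forward im′ in punchIn i′ j , e′j≡v

NumFaces-injective⇒≤ :
  ∀ {k k′} {A : (Fin k → Subset n) → Set} {B : (Fin k′ → Subset n) → Set} {m m′} →
  NumFaces {n} {k} {A} m → NumFaces {n} {k′} {B} m′ →
  (φ : Σ _ A → Σ _ B) → (∀ F G → SameFace (φ F) (φ G) → SameFace F G) → m ℕ.≤ m′
NumFaces-injective⇒≤ (f , _ , f-inj) (f′ , f′-onto , _) φ φ-reflects = injective⇒≤ g-inj
  where
  g : Fin _ → Fin _
  g i = proj₁ (f′-onto (φ (f i)))
  g-inj : ∀ {i j} → g i ≡ g j → i ≡ j
  g-inj {i} {j} gi≡gj = f-inj i j (φ-reflects (f i) (f j)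
    (SameImage-trans (SameImage-sym (proj₂ (f′-onto (φ (f i)))))
                     (subst (λ l → SameFace (f′ l) (φ (f j))) (sym gi≡gj) (proj₂ (f′-onto (φ (f j)))))))

CoeffS-split : {V : Subset n → Set} {b g : ℕ} → CoeffS⁰ V k b → CoeffS¹ V k g → CoeffS V k (b ℕ.+ g)
CoeffS-split {n = n} {k} {V} {b} {g} (f⁰ , onto⁰ , inj⁰) (f¹ , onto¹ , inj¹) =
  f ∘ splitAt b , onto , λ i j same → begin
    i                     ≡⟨ join-splitAt b g i ⟨
    join b g (splitAt b i) ≡⟨ cong (join b g) (inj (splitAt b i) (splitAt b j) same) ⟩
    join b g (splitAt b j) ≡⟨ join-splitAt b g j ⟩
    j                     ∎
  where
  f : Fin b ⊎ Fin g → SimplexFace V k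
  f (inj₁ i) = let (e , face , ind , _) = f⁰ i in e , face , ind
  f (inj₂ i) = let (e , face , ind , _) = f¹ i in e , face , ind
  rejoin : ∀ {F} x → SameFace (f x) F → SameFace (f (splitAt b (join b g x))) F
  rejoin {F} x = subst (λ y → SameFace (f y) F) (sym (splitAt-join b g x))
  onto : ∀ F → ∃ λ i → SameFace (f (splitAt b i)) F
  onto (e , face , ind) with any? (λ i → ≡-dec-Vec _≟ᵇ_ (e i) ⊥)
  ... | yes ∋⊥ = let (i , same) = onto⁰ (e , face , ind , ∋⊥) in
                 join b g (inj₁ i) , rejoin {e , face , ind} (inj₁ i) same
  ... | no ∌⊥  = let (i , same) = onto¹ (e , face , ind , ∌⊥) in
                 join b g (inj₂ i) , rejoin {e , face , ind} (inj₂ i) same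
  ∋⊥⁰ : ∀ i → ContainsOrigin (proj₁ (f⁰ i))
  ∋⊥⁰ i = proj₂ (proj₂ (proj₂ (f⁰ i)))
  ∌⊥¹ : ∀ i → ¬ ContainsOrigin (proj₁ (f¹ i))
  ∌⊥¹ i = proj₂ (proj₂ (proj₂ (f¹ i)))
  inj : ∀ x y → SameFace (f x) (f y) → x ≡ y
  inj (inj₁ i) (inj₁ j) same = cong inj₁ (inj⁰ i j same)
  inj (inj₂ i) (inj₂ j) same = cong inj₂ (inj¹ i j same)
  inj (inj₁ i) (inj₂ j) same = ⊥-elim (∌⊥¹ j (proj₁ (same ⊥) (∋⊥⁰ i)))
  inj (inj₂ i) (inj₁ j) same = ⊥-elim (∌⊥¹ i (proj₂ (same ⊥) (∋⊥⁰ j)))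

allSubsets : ∀ n → List (Subset n)
allSubsets zero    = Vec.[] ∷ []
allSubsets (suc n) = cartesianProductWith Vec._∷_ (true ∷ false ∷ []) (allSubsets n)

∈-allSubsets : (x : Subset n) → x ∈ₗ allSubsets n
∈-allSubsets Vec.[]          = here refl
∈-allSubsets (true Vec.∷ x)  = ∈-cartesianProductWith⁺ Vec._∷_ {xs = true ∷ false ∷ []}
                                 (here refl) (∈-allSubsets x)
∈-allSubsets (false Vec.∷ x) = ∈-cartesianProductWith⁺ Vec._∷_ {xs = true ∷ false ∷ []}
                                 (there (here refl)) (∈-allSubsets x)

allFunctions : {X : Set} → List X → ∀ k → List (Fin k → X)
allFunctions xs zero    = Vector.[] ∷ []
allFunctions xs (suc k) = cartesianProductWith Vector._∷_ xs (allFunctions xs k)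

∈-allFunctions : {X : Set} {xs : List X} → (∀ x → x ∈ₗ xs) →
                 (f : Fin k → X) → ∃ λ f′ → f′ ∈ₗ allFunctions xs k × f′ ≗ f
∈-allFunctions {zero}  all f = Vector.[] , here refl , λ ()
∈-allFunctions {suc k} all f =
  let (f′ , f′∈ , f′≗) = ∈-allFunctions all (f ∘ suc) in
  f zero Vector.∷ f′ , ∈-cartesianProductWith⁺ Vector._∷_ (all (f zero)) f′∈ ,
  λ { zero → refl ; (suc i) → f′≗ i }

module _ {A : (Fin k → Subset n) → Set} where

  private
    Covers : List (Fin k → Subset n) → (Fin m → Σ _ A) → Set
    Covers cs f = ∀ {c} → c ∈ₗ cs → (F : Σ _ A) → SameImage c (proj₁ F) → ∃ λ i → SameFace (f i) F

    Distinct : (Fin m → Σ _ A) → Set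
    Distinct f = ∀ i j → SameFace (f i) (f j) → i ≡ j

    -- Classically one decides, candidate by candidate, whether it
    -- enumerates a face not met before.
    partialCount : (cs : List (Fin k → Subset n)) →
                   ¬ ¬ (Σ ℕ λ m → Σ (Fin m → Σ _ A) λ f → Covers cs f × Distinct f)
    partialCount [] = pure (0 , (λ ()) , (λ ()) , (λ ()))
    partialCount (c ∷ cs) = do
      (m , f , covers , distinct) ← partialCount cs
      yes (F , c≈F) ← ¬¬-excluded-middle {A = ∃ λ (F : Σ _ A) → SameImage c (proj₁ F)}
        where no ∄F → pure (m , f , (λ { (here refl) G c≈G → ⊥-elim (∄F (G , c≈G))
                                          ; (there c∈) → covers c∈ }) , distinct)
      yes (i , fi≈F) ← ¬¬-excluded-middle {A = ∃ λ i → SameFace (f i) F}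
        where no new → pure (suc m , F Vector.∷ f ,
                             (λ { (here refl) G c≈G → zero , SameImage-trans (SameImage-sym c≈F) c≈G
                                ; (there c∈) G c′≈G → let (i , fi≈G) = covers c∈ G c′≈G in suc i , fi≈G }) ,
                             (λ { zero    zero    _    → refl
                                ; zero    (suc j) F≈fj → ⊥-elim (new (j , SameImage-sym F≈fj))
                                ; (suc i) zero    fi≈F → ⊥-elim (new (i , fi≈F))
                                ; (suc i) (suc j) fi≈fj → cong suc (distinct i j fi≈fj) }))
      pure (m , f , (λ { (here refl) G c≈G → i , SameImage-trans fi≈F (SameImage-trans (SameImage-sym c≈F) c≈G)
                       ; (there c∈) → covers c∈ }) , distinct)

  NumFaces-exists : ¬ ¬ (Σ ℕ λ m → NumFaces {n} {k} {A} m)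
  NumFaces-exists = do
    (m , f , covers , distinct) ← partialCount (allFunctions (allSubsets n) k)
    pure (m , f , onto {f = f} covers , distinct)
    where
    onto : ∀ {m} {f : Fin m → Σ _ A} → Covers (allFunctions (allSubsets n) k) f → ∀ F → ∃ λ i → SameFace (f i) F
    onto covers F = let (e , e∈ , e≗) = ∈-allFunctions ∈-allSubsets (proj₁ F) in covers e∈ F (SameImage-≗ e≗)

IsFaceEnum-empty : {V : Subset n → Set} (e : Fin 0 → Subset n) → IsFaceEnum V e
IsFaceEnum-empty {n = n} e = (λ ()) , (λ ()) , (λ _ → 0ℤ) , 1ℤ , (λ v _ → subst (_≤ 1ℤ) (sym (dot0 v)) (+≤+ z≤n)) ,
                             (λ ()) , (λ v _ 0≡1 → ⊥-elim (0≢1 (trans (sym (dot0 v)) 0≡1)))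
  where
  dot0 : ∀ v → dot {n} (λ _ → 0ℤ) v ≡ 0ℤ
  dot0 v = sumℤ-zero {f = λ p → 0ℤ * χ v p} (λ _ → refl)
  0≢1 : 0ℤ ≢ 1ℤ
  0≢1 ()

module Face {V : Subset n → Set} {e : Fin k → Subset n} (face : IsFaceEnum V e) where

  vertex : ∀ i → V (e i)
  vertex = proj₁ face

  injective : ∀ i j → e i ≡ e j → i ≡ j
  injective = proj₁ (proj₂ face)

  normal : Fin n → ℤ
  normal = proj₁ (proj₂ (proj₂ face))

  height : ℤ
  height = proj₁ (proj₂ (proj₂ (proj₂ face)))

  valid : ∀ v → V v → dot normal v ≤ height
  valid = proj₁ (proj₂ (proj₂ (proj₂ (proj₂ face))))

  tight : ∀ i → dot normal (e i) ≡ height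
  tight = proj₁ (proj₂ (proj₂ (proj₂ (proj₂ (proj₂ face)))))

  exposed : ∀ v → V v → dot normal v ≡ height → Image e v
  exposed = proj₂ (proj₂ (proj₂ (proj₂ (proj₂ (proj₂ face)))))

  height≡0 : ContainsOrigin e → height ≡ 0ℤ
  height≡0 (i , ei≡⊥) = trans (sym (tight i)) (trans (cong (dot normal) ei≡⊥) (dot-⊥ normal))

  vertex-Image : ∀ {x} → Image e x → V x
  vertex-Image (i , ei≡x) = subst V ei≡x (vertex i)

  tight-Image : ∀ {x} → Image e x → dot normal x ≡ height
  tight-Image (i , ei≡x) = trans (cong (dot normal) (sym ei≡x)) (tight i)

  ∪∩-∈ : ∀ {x y} → Image e x → Image e y → V (x ∪ y) → V (x ∩ y) → Image e (x ∪ y) × Image e (x ∩ y)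
  ∪∩-∈ {x} {y} x∈ y∈ V∪ V∩ with ≤-+-tight (valid _ V∪) (valid _ V∩)
                                  (trans (dot-∪∩ normal x y) (cong₂ _+_ (tight-Image x∈) (tight-Image y∈)))
  ... | ∪-tight , ∩-tight = exposed _ V∪ ∪-tight , exposed _ V∩ ∩-tight

  -- The normal is ≤ 0 on V and vanishes on e i, the disjoint union of y and e i ∩ ∁ y.
  ⊆-∈ : (∀ {x y} → V x → y ⊆ x → V y) → ContainsOrigin e → ∀ i {y} → y ⊆ e i → Image e y
  ⊆-∈ down ∋⊥ i {y} y⊆ei = exposed y (down (vertex i) y⊆ei) (proj₁ (≤-+-tight
      (valid y (down (vertex i) y⊆ei)) (valid _ (down (vertex i) (p∩q⊆p (e i) (∁ y))))
      (begin
        dot normal y + dot normal (e i ∩ ∁ y) ≡⟨ dot-∩∁ normal y⊆ei ⟨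
        dot normal (e i)                      ≡⟨ tight i ⟩
        height                                ≡⟨ height≡0 ∋⊥ ⟩
        0ℤ                                    ≡⟨ cong₂ _+_ (height≡0 ∋⊥) (height≡0 ∋⊥) ⟨
        height + height                       ∎)))

b2z≤1 : ∀ b → b2z b ≤ 1ℤ
b2z≤1 false = +≤+ z≤n
b2z≤1 true  = +≤+ (s≤s z≤n)

-- Adding the coordinate p to the normal cuts the origin off the face.
IsFaceEnum-removeAt : {V : Subset n → Set} {e : Fin (suc k) → Subset n} → IsFaceEnum V e →
                      ∀ {i} → e i ≡ ⊥ → ∀ {p} → (∀ j → j ≢ i → p ∈ e j) → IsFaceEnum V (removeAt e i)
IsFaceEnum-removeAt {V = V} {e} face {i} ei≡⊥ {p} p∈ej =
  vertex ∘ punchIn i , (λ j j′ eq → punchIn-injective i j j′ (injective _ _ eq)) ,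
  normal′ , 1ℤ , valid′ , tight′ , exposed′
  where
  open Face face
  normal′ : Fin _ → ℤ
  normal′ r = normal r + δ p r
  dot-normal′ : ∀ v → dot normal′ v ≡ dot normal v + χ v p
  dot-normal′ v = trans (dot-+ normal (δ p) v) (cong (_+_ (dot normal v)) (dot-δ p v))
  height≡0′ : height ≡ 0ℤ
  height≡0′ = height≡0 (i , ei≡⊥)
  valid₀ : ∀ v → V v → dot normal v ≤ 0ℤ
  valid₀ v Vv = subst (dot normal v ≤_) height≡0′ (valid v Vv)
  valid′ : ∀ v → V v → dot normal′ v ≤ 1ℤ
  valid′ v Vv = subst (_≤ 1ℤ) (sym (dot-normal′ v)) (ℤP.+-mono-≤ (valid₀ v Vv) (b2z≤1 (lookup v p)))
  tight′ : ∀ j → dot normal′ (e (punchIn i j)) ≡ 1ℤ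
  tight′ j = trans (dot-normal′ (e (punchIn i j)))
                   (cong₂ _+_ (trans (tight (punchIn i j)) height≡0′) (χ-∈ (p∈ej _ (punchInᵢ≢i i j))))
  exposed′ : ∀ v → V v → dot normal′ v ≡ 1ℤ → Image (removeAt e i) v
  exposed′ v Vv eq with ≤-+-tight (valid₀ v Vv) (b2z≤1 (lookup v p)) (trans (sym (dot-normal′ v)) eq)
  ... | normal·v≡0 , χvp≡1 with exposed v Vv (trans normal·v≡0 (sym height≡0′))
  ... | j , ej≡v with i ≟ᶠ j
  ... | yes refl = ⊥-elim (0≢1 (trans (sym (χ-⊥ p)) (subst (λ x → χ x p ≡ 1ℤ) (trans (sym ej≡v) ei≡⊥) χvp≡1)))
    where
    0≢1 : 0ℤ ≢ 1ℤ
    0≢1 ()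
  ... | no i≢j   = punchOut i≢j , trans (cong e (punchIn-punchOut i≢j)) ej≡v

greatest : {P : Fin m → Set} (R : Fin m → Fin m → Set) → (∀ i → Dec (P i)) →
           (∀ {i j} → P i → P j → R i j ⊎ R j i) → (∀ {i j l} → R i j → R j l → R i l) →
           ∃ P → ∃ λ g → P g × (∀ i → P i → R i g)
greatest {suc m} {P} R P? total trans (i , Pi) with any? (P? ∘ suc)
... | no ∄Psuc = zero , P0 i Pi , λ { zero P0′ → reduce (total P0′ P0′) ; (suc j) Pj → ⊥-elim (∄Psuc (j , Pj)) }
  where
  P0 : ∀ i → P i → P zero
  P0 zero    Pi = Pi
  P0 (suc j) Pj = ⊥-elim (∄Psuc (j , Pj))
... | yes ∃Psuc with greatest (λ i j → R (suc i) (suc j)) (P? ∘ suc) total trans ∃Psuc | P? zero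
...   | g , Pg , max | no ¬P0 = suc g , Pg , λ { zero P0 → ⊥-elim (¬P0 P0) ; (suc j) Pj → max j Pj }
...   | g , Pg , max | yes P0 with total P0 Pg
...     | inj₁ R0g = suc g , Pg , λ { zero _ → R0g ; (suc j) Pj → max j Pj }
...     | inj₂ Rg0 = zero , P0 , λ { zero _ → reduce (total P0 P0) ; (suc j) Pj → trans (max j Pj) Rg0 }

-- Vertex sets closed under union and intersection

module LatticeClosed {V : Subset n → Set}
                     (V-∪ : ∀ x y → V x → V y → V (x ∪ y))
                     (V-∩ : ∀ x y → V x → V y → V (x ∩ y)) where

  simplex-comparable : {e : Fin k → Subset n} → IsFaceEnum V e → AffInd e →
                       ∀ i j → e j ⊆ e i ⊎ e i ⊆ e j
  simplex-comparable {e = e} face ind i j =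
    AffInd-comparable {e = e} ind (i , refl) (j , refl) ∪∈ ∩∈
    where
    open Face face
    ∪∩∈ = ∪∩-∈ (i , refl) (j , refl) (V-∪ (e i) (e j) (vertex i) (vertex j)) (V-∩ (e i) (e j) (vertex i) (vertex j))
    ∪∈ = proj₁ ∪∩∈
    ∩∈ = proj₂ ∪∩∈

  -- The smallest vertex other than the origin lies in all the others.
  simplex-common-element : {e : Fin (suc (suc k)) → Subset n} → IsFaceEnum V e → AffInd e →
                           ∀ {i} → e i ≡ ⊥ → ∃ λ p → ∀ j → j ≢ i → p ∈ e j
  simplex-common-element {e = e} face ind {i} ei≡⊥
    with greatest (λ j j′ → e j′ ⊆ e j) (λ j → ¬? (j ≟ᶠ i))
                  (λ {j} {j′} _ _ → simplex-comparable face ind j j′)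
                  (λ ej⊆ei ek⊆ej → ⊆-trans ek⊆ej ej⊆ei) (other i)
    where
    other : ∀ {k} (i : Fin (suc (suc k))) → ∃ λ j → j ≢ i
    other zero    = suc zero , λ ()
    other (suc _) = zero , λ ()
  ... | M , M≢i , M-least with nonempty? (e M)
  ... | yes (p , p∈eM) = p , λ j j≢i → M-least j j≢i p∈eM
  ... | no eM-empty    = ⊥-elim (M≢i (Face.injective face M i (trans (Empty-unique eM-empty) (sym ei≡⊥))))

  removeOrigin : SimplexFace⁰ V (suc k) → SimplexFace¹ V k
  removeOrigin {k} (e , face , ind , (i , ei≡⊥)) =
    removeAt e i , face′ k e face ind ei≡⊥ , AffInd-removeAt {e = e} ind i , ⊥∉
    where
    face′ : ∀ k (e : Fin (suc k) → Subset n) → IsFaceEnum V e → AffInd e →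
            ∀ {i} → e i ≡ ⊥ → IsFaceEnum V (removeAt e i)
    face′ zero    e face ind ei≡⊥ = IsFaceEnum-empty (removeAt e _)
    face′ (suc k) e face ind ei≡⊥ =
      let (p , p∈) = simplex-common-element face ind ei≡⊥ in IsFaceEnum-removeAt face ei≡⊥ p∈
    ⊥∉ : ¬ ContainsOrigin (removeAt e i)
    ⊥∉ (j , eq) = punchInᵢ≢i i j (Face.injective face _ _ (trans eq (sym ei≡⊥)))

  removeOrigin-reflects : (F G : SimplexFace⁰ V (suc k)) → SameFace (removeOrigin F) (removeOrigin G) → SameFace F G
  removeOrigin-reflects (_ , _ , _ , (_ , ei≡⊥)) (_ , _ , _ , (_ , e′i′≡⊥)) =
    SameImage-removeAt⁻ (trans ei≡⊥ (sym e′i′≡⊥))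

  CoeffS⁰-suc≤CoeffS¹ : ∀ {b g} → CoeffS⁰ V (suc k) b → CoeffS¹ V k g → b ℕ.≤ g
  CoeffS⁰-suc≤CoeffS¹ Cb Cg = NumFaces-injective⇒≤ Cb Cg removeOrigin removeOrigin-reflects

b2n-mono : ∀ {a b} → (a ≡ true → b ≡ true) → b2n a ℕ.≤ b2n b
b2n-mono {false} _   = z≤n
b2n-mono {true}  a⇒b rewrite a⇒b refl = s≤s z≤n

b2n-≤-true : ∀ {a b} → b2n a ℕ.≤ b2n b → a ≡ true → b ≡ true
b2n-≤-true {true} {true}  _        _ = refl
b2n-≤-true {true} {false} () _

sumAt-mono : ∀ {x y : Subset n} → y ⊆ x → ∀ ps → sumAt y ps ℕ.≤ sumAt x ps
sumAt-mono y⊆x []       = z≤n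
sumAt-mono {x = x} {y} y⊆x (p ∷ ps) =
  ℕP.+-mono-≤ (b2n-mono (λ yp → []=⇒lookup (y⊆x (lookup⇒[]= p y yp)))) (sumAt-mono y⊆x ps)

sumAt-∉ : ∀ {x : Subset n} {ps} → All (_∉ x) ps → sumAt x ps ≡ 0
sumAt-∉ []           = refl
sumAt-∉ (p∉x ∷ ps∉x) = cong₂ ℕ._+_ (cong b2n (∉⇒lookup≡false p∉x)) (sumAt-∉ ps∉x)

module _ {_≼_ : Fin n → Fin n → Set} where

  IsUpSet : Subset n → Set
  IsUpSet x = ∀ {p q} → p ≼ q → p ∈ x → q ∈ x

  OrderVertex⇒IsUpSet : ∀ {x} → OrderVertex _≼_ x → IsUpSet x
  OrderVertex⇒IsUpSet {x} ov {p} {q} p≼q p∈x = lookup⇒[]= q x (b2n-≤-true (ov p q p≼q) ([]=⇒lookup p∈x))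

  IsUpSet⇒OrderVertex : ∀ {x} → IsUpSet x → OrderVertex _≼_ x
  IsUpSet⇒OrderVertex {x} up p q p≼q = b2n-mono (λ xp≡true → []=⇒lookup (up p≼q (lookup⇒[]= p x xp≡true)))

  OrderVertex-∪ : ∀ x y → OrderVertex _≼_ x → OrderVertex _≼_ y → OrderVertex _≼_ (x ∪ y)
  OrderVertex-∪ x y ox oy = IsUpSet⇒OrderVertex λ p≼q p∈x∪y →
    x∈p∪q⁺ (Sum.map (OrderVertex⇒IsUpSet ox p≼q) (OrderVertex⇒IsUpSet oy p≼q) (x∈p∪q⁻ x y p∈x∪y))

  OrderVertex-∩ : ∀ x y → OrderVertex _≼_ x → OrderVertex _≼_ y → OrderVertex _≼_ (x ∩ y)
  OrderVertex-∩ x y ox oy = IsUpSet⇒OrderVertex λ p≼q p∈x∩y →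
    let (p∈x , p∈y) = x∈p∩q⁻ x y p∈x∩y in
    x∈p∩q⁺ (OrderVertex⇒IsUpSet ox p≼q p∈x , OrderVertex⇒IsUpSet oy p≼q p∈y)

  ChainVertex-⊆ : ∀ {x y} → ChainVertex _≼_ x → y ⊆ x → ChainVertex _≼_ y
  ChainVertex-⊆ cx y⊆x ps chain = ℕP.≤-trans (sumAt-mono y⊆x ps) (cx ps chain)

  IsChain-tail : ∀ {p ps} → IsChain _≼_ (p ∷ ps) → IsChain _≼_ ps
  IsChain-tail {ps = []}    _               = tt
  IsChain-tail {ps = _ ∷ _} (_ , _ , chain) = chain

  module _ (po : IsPartialOrder _≡_ _≼_) where
    private module ≼ = IsPartialOrder po

    IsChain-above : ∀ {p ps} → IsChain _≼_ (p ∷ ps) → All (λ r → p ≼ r × p ≢ r) ps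
    IsChain-above {ps = []}     _                   = []
    IsChain-above {ps = q ∷ qs} (p≼q , p≢q , chain) = (p≼q , p≢q) ∷ All.map above (IsChain-above chain)
      where
      above : ∀ {r} → q ≼ r × q ≢ r → _ ≼ r × _ ≢ r
      above (q≼r , _) = ≼.trans p≼q q≼r , λ { refl → p≢q (≼.antisym p≼q q≼r) }

    antichain⇒ChainVertex : ∀ {x} → (∀ {p q} → p ∈ x → q ∈ x → p ≼ q → p ≡ q) → ChainVertex _≼_ x
    antichain⇒ChainVertex         anti []       _     = z≤n
    antichain⇒ChainVertex {x} anti (p ∷ ps) chain with p ∈? x
    ... | no p∉x  = subst (λ b → b2n b ℕ.+ sumAt x ps ℕ.≤ 1) (sym (∉⇒lookup≡false p∉x))
                          (antichain⇒ChainVertex anti ps (IsChain-tail chain))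
    ... | yes p∈x = subst₂ (λ b s → b2n b ℕ.+ s ℕ.≤ 1) (sym ([]=⇒lookup p∈x)) (sym (sumAt-∉ rest∉x)) (s≤s z≤n)
      where
      rest∉x : All (_∉ x) ps
      rest∉x = All.map (λ (p≼r , p≢r) r∈x → p≢r (anti p∈x r∈x p≼r)) (IsChain-above chain)

-- Simplex faces of the chain polytope through the origin

⁅⁆⊆ : {x : Subset n} {p : Fin n} → p ∈ x → ⁅ p ⁆ ⊆ x
⁅⁆⊆ {x = x} {p} p∈x r∈⁅p⁆ = subst (_∈ x) (sym (x∈⁅y⁆⇒x≡y p r∈⁅p⁆)) p∈x

∈⁅⁆∪⁅⁆ : {p q r : Fin n} → r ∈ ⁅ p ⁆ ∪ ⁅ q ⁆ → r ≡ p ⊎ r ≡ q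
∈⁅⁆∪⁅⁆ {p = p} {q} r∈ = Sum.map (x∈⁅y⁆⇒x≡y p) (x∈⁅y⁆⇒x≡y q) (x∈p∪q⁻ ⁅ p ⁆ ⁅ q ⁆ r∈)

EmptyOrSingleton : Subset n → Set
EmptyOrSingleton x = x ≡ ⊥ ⊎ ∃ λ c → x ≡ ⁅ c ⁆

subsingleton-shape : {x : Subset n} → (∀ {p q} → p ∈ x → q ∈ x → p ≡ q) → EmptyOrSingleton x
subsingleton-shape {x = x} unique with nonempty? x
... | no empty      = inj₁ (Empty-unique empty)
... | yes (c , c∈x) =
  inj₂ (c , ⊆-antisym (λ {p} p∈x → subst (_∈ ⁅ c ⁆) (sym (unique p∈x c∈x)) (x∈⁅x⁆ c)) (⁅⁆⊆ c∈x))

module ChainSimplex {_≼_ : Fin n → Fin n → Set} (po : IsPartialOrder _≡_ _≼_)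
                    {e : Fin k → Subset n} (face : IsFaceEnum (ChainVertex _≼_) e) (ind : AffInd e)
                    (∋⊥ : ContainsOrigin e) where
  open Face face
  private module ≼ = IsPartialOrder po

  -- ⁅ p ⁆, ⁅ q ⁆, their union and their intersection all lie below x, hence on the face.
  Image-subsingleton : ∀ {x p q} → Image e x → p ∈ x → q ∈ x → p ≡ q
  Image-subsingleton {x} {p} {q} (i , ei≡x) p∈x q∈x =
    [ (λ ⁅q⁆⊆⁅p⁆ → sym (x∈⁅y⁆⇒x≡y p (⁅q⁆⊆⁅p⁆ (x∈⁅x⁆ q))))
    , (λ ⁅p⁆⊆⁅q⁆ → x∈⁅y⁆⇒x≡y q (⁅p⁆⊆⁅q⁆ (x∈⁅x⁆ p))) ]′
      (AffInd-comparable {e = e} ind (below (⁅⁆⊆ p∈x)) (below (⁅⁆⊆ q∈x))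
         (below (λ r∈ → [ (λ r≡p → subst (_∈ x) (sym r≡p) p∈x)
                        , (λ r≡q → subst (_∈ x) (sym r≡q) q∈x) ]′ (∈⁅⁆∪⁅⁆ r∈)))
         (below (⊆-trans (p∩q⊆p ⁅ p ⁆ ⁅ q ⁆) (⁅⁆⊆ p∈x))))
    where
    below : ∀ {y} → y ⊆ x → Image e y
    below {y} y⊆x = ⊆-∈ ChainVertex-⊆ ∋⊥ i (subst (y ⊆_) (sym ei≡x) y⊆x)

  vertex-shape : ∀ i → EmptyOrSingleton (e i)
  vertex-shape i = subsingleton-shape (Image-subsingleton (i , refl))

  -- For incomparable p and q, ⁅ p ⁆ ∪ ⁅ q ⁆ would be a two-element vertex of the face.
  singletons-comparable : (∀ p q → Dec (p ≼ q)) → ∀ {p q} → Image e ⁅ p ⁆ → Image e ⁅ q ⁆ → p ≼ q ⊎ q ≼ p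
  singletons-comparable _≼?_ {p} {q} p∈ q∈ with p ≼? q | q ≼? p
  ... | yes p≼q | _       = inj₁ p≼q
  ... | no _    | yes q≼p = inj₂ q≼p
  ... | no p⋠q  | no q⋠p  = ⊥-elim (p⋠q (subst (p ≼_) (Image-subsingleton pair∈ p∈pair q∈pair) ≼.refl))
    where
    antichain : ∀ {r s} → r ∈ ⁅ p ⁆ ∪ ⁅ q ⁆ → s ∈ ⁅ p ⁆ ∪ ⁅ q ⁆ → r ≼ s → r ≡ s
    antichain r∈ s∈ r≼s with ∈⁅⁆∪⁅⁆ r∈ | ∈⁅⁆∪⁅⁆ s∈
    ... | inj₁ refl | inj₁ refl = refl
    ... | inj₁ refl | inj₂ refl = ⊥-elim (p⋠q r≼s)
    ... | inj₂ refl | inj₁ refl = ⊥-elim (q⋠p r≼s)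
    ... | inj₂ refl | inj₂ refl = refl
    pair∈ : Image e (⁅ p ⁆ ∪ ⁅ q ⁆)
    pair∈ = proj₁ (∪∩-∈ p∈ q∈ (antichain⇒ChainVertex po antichain)
                             (ChainVertex-⊆ (vertex-Image p∈) (p∩q⊆p ⁅ p ⁆ ⁅ q ⁆)))
    p∈pair : p ∈ ⁅ p ⁆ ∪ ⁅ q ⁆
    p∈pair = p⊆p∪q ⁅ q ⁆ (x∈⁅x⁆ p)
    q∈pair : q ∈ ⁅ p ⁆ ∪ ⁅ q ⁆
    q∈pair = q⊆p∪q ⁅ p ⁆ ⁅ q ⁆ (x∈⁅x⁆ q)

-- Upward closure

module UpClosure {_≼_ : Fin n → Fin n → Set} (po : IsPartialOrder _≡_ _≼_) (_≼?_ : ∀ p q → Dec (p ≼ q)) where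
  private module ≼ = IsPartialOrder po

  ↑ : Subset n → Subset n
  ↑ x = Vec.tabulate (does ∘ λ q → any? (λ p → (p ∈? x) ×-dec (p ≼? q)))

  ∈↑⁻ : ∀ {x q} → q ∈ ↑ x → ∃ λ p → p ∈ x × p ≼ q
  ∈↑⁻ {x} = ∈-tabulate⁻ (λ q → any? (λ p → (p ∈? x) ×-dec (p ≼? q)))

  ∈↑⁺ : ∀ {x p q} → p ∈ x → p ≼ q → q ∈ ↑ x
  ∈↑⁺ {x} {p} p∈x p≼q = ∈-tabulate⁺ (λ q → any? (λ p → (p ∈? x) ×-dec (p ≼? q))) (p , p∈x , p≼q)

  ↑-IsUpSet : ∀ x → IsUpSet {_≼_ = _≼_} (↑ x)
  ↑-IsUpSet x q≼r q∈↑x = let (p , p∈x , p≼q) = ∈↑⁻ q∈↑x in ∈↑⁺ p∈x (≼.trans p≼q q≼r)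

  ↑⊥ : ↑ ⊥ ≡ ⊥
  ↑⊥ = Empty-unique (λ (q , q∈↑⊥) → let (p , p∈⊥ , _) = ∈↑⁻ q∈↑⊥ in ∉⊥ p∈⊥)

  ∈↑⁅⁆⁻ : ∀ {c q} → q ∈ ↑ ⁅ c ⁆ → c ≼ q
  ∈↑⁅⁆⁻ {c} q∈↑c = let (p , p∈⁅c⁆ , p≼q) = ∈↑⁻ q∈↑c in subst (_≼ _) (x∈⁅y⁆⇒x≡y c p∈⁅c⁆) p≼q

  ∈↑⁅⁆⁺ : ∀ {c q} → c ≼ q → q ∈ ↑ ⁅ c ⁆
  ∈↑⁅⁆⁺ {c} = ∈↑⁺ (x∈⁅x⁆ c)

  ↑-injective : ∀ {x y} → EmptyOrSingleton x → EmptyOrSingleton y → ↑ x ≡ ↑ y → x ≡ y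
  ↑-injective (inj₁ refl)       (inj₁ refl)       _ = refl
  ↑-injective (inj₁ refl)       (inj₂ (d , refl)) eq =
    ⊥-elim (∉⊥ (subst (_ ∈_) (trans (sym eq) ↑⊥) (∈↑⁅⁆⁺ ≼.refl)))
  ↑-injective (inj₂ (c , refl)) (inj₁ refl)       eq =
    ⊥-elim (∉⊥ (subst (_ ∈_) (trans eq ↑⊥) (∈↑⁅⁆⁺ ≼.refl)))
  ↑-injective (inj₂ (c , refl)) (inj₂ (d , refl)) eq = cong ⁅_⁆ (≼.antisym
    (∈↑⁅⁆⁻ (subst (_ ∈_) (sym eq) (∈↑⁅⁆⁺ ≼.refl))) (∈↑⁅⁆⁻ (subst (_ ∈_) eq (∈↑⁅⁆⁺ ≼.refl))))

  -- The coordinate c of an affine combination of the ↑ (e i) only sees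
  -- the vertices ⁅ d ⁆ with d ≼ c: the system is triangular.
  AffInd-↑ : {e : Fin k → Subset n} → (∀ i → EmptyOrSingleton (e i)) → (∀ i j → e i ≡ e j → i ≡ j) →
             AffInd (↑ ∘ e)
  AffInd-↑ {e = e} shape e-injective a Σa≡0 Σa↑e≡0 = coefficient
    where
    singleton-coefficient : ∀ c → Acc _ c → ∀ i → e i ≡ ⁅ c ⁆ → a i ≡ 0ℤ
    singleton-coefficient c (acc smaller) i ei≡⁅c⁆ = begin
      a i                              ≡⟨ ℤP.*-identityʳ (a i) ⟨
      a i * 1ℤ                         ≡⟨ cong (a i *_) (χ-∈ c∈↑ei) ⟨
      a i * χ (↑ (e i)) c              ≡⟨ sumℤ-single i others ⟨
      sumℤ (λ t → a t * χ (↑ (e t)) c) ≡⟨ Σa↑e≡0 c ⟩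
      0ℤ                               ∎
      where
      c∈↑ei : c ∈ ↑ (e i)
      c∈↑ei = subst (c ∈_) (cong ↑ (sym ei≡⁅c⁆)) (∈↑⁅⁆⁺ ≼.refl)
      others : ∀ t → t ≢ i → a t * χ (↑ (e t)) c ≡ 0ℤ
      others t t≢i with shape t
      ... | inj₁ et≡⊥ = begin
        a t * χ (↑ (e t)) c   ≡⟨ cong (λ x → a t * χ (↑ x) c) et≡⊥ ⟩
        a t * χ (↑ ⊥) c       ≡⟨ cong (λ x → a t * χ x c) ↑⊥ ⟩
        a t * χ ⊥ c           ≡⟨ cong (a t *_) (χ-⊥ c) ⟩
        a t * 0ℤ              ≡⟨ ℤP.*-zeroʳ (a t) ⟩
        0ℤ                    ∎
      ... | inj₂ (d , et≡⁅d⁆) with d ≼? c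
      ...   | yes d≼c = trans (cong (_* χ (↑ (e t)) c) (singleton-coefficient d (smaller (d≼c , d≢c)) t et≡⁅d⁆))
                              (ℤP.*-zeroˡ (χ (↑ (e t)) c))
        where
        d≢c : d ≢ c
        d≢c refl = t≢i (e-injective t i (trans et≡⁅d⁆ (sym ei≡⁅c⁆)))
      ...   | no d⋠c  = trans (cong (a t *_) (χ-∉ (λ c∈ → d⋠c (∈↑⁅⁆⁻ (subst (c ∈_) (cong ↑ et≡⁅d⁆) c∈)))))
                              (ℤP.*-zeroʳ (a t))
    coefficient : ∀ i → a i ≡ 0ℤ
    coefficient i with shape i
    ... | inj₂ (c , ei≡⁅c⁆) = singleton-coefficient c (po-wellFounded po c) i ei≡⁅c⁆
    ... | inj₁ ei≡⊥ = trans (sym (sumℤ-single i others)) Σa≡0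
      where
      others : ∀ t → t ≢ i → a t ≡ 0ℤ
      others t t≢i with shape t
      ... | inj₁ et≡⊥ = ⊥-elim (t≢i (e-injective t i (trans et≡⊥ (sym ei≡⊥))))
      ... | inj₂ (d , et≡⁅d⁆) = singleton-coefficient d (po-wellFounded po d) t et≡⁅d⁆

  module ChainImage {e : Fin k → Subset n} (shape : ∀ i → EmptyOrSingleton (e i))
                    (e-injective : ∀ i j → e i ≡ e j → i ≡ j) (∋⊥ : ContainsOrigin e)
                    (chain : ∀ {c d} → Image e ⁅ c ⁆ → Image e ⁅ d ⁆ → c ≼ d ⊎ d ≼ c) where

    InChain : Fin n → Set
    InChain c = Image e ⁅ c ⁆

    InChain? : ∀ c → Dec (InChain c)
    InChain? c = any? (λ i → ≡-dec-Vec _≟ᵇ_ (e i) ⁅ c ⁆)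

    -- On the face, x q is the value of x at the largest chain element
    -- below q, or 0 if there is none.
    Tied : Fin n → Fin n → Set
    Tied p q = p ≼ q × (∀ c → InChain c → c ≼ q → c ≼ p)

    Tied? : ∀ p q → Dec (Tied p q)
    Tied? p q = (p ≼? q) ×-dec all? (λ c → InChain? c →-dec (c ≼? q) →-dec (c ≼? p))

    Unreached : Fin n → Set
    Unreached q = ∀ c → InChain c → ¬ c ≼ q

    Unreached? : ∀ q → Dec (Unreached q)
    Unreached? q = all? (λ c → InChain? c →-dec ¬? (c ≼? q))

    tiedTerm : Fin n → Fin n → Subset n → ℤ
    tiedTerm p q x = 𝟙 (Tied? p q) * (χ x p - χ x q)

    unreachedTerm : Fin n → Subset n → ℤ
    unreachedTerm q x = 𝟙 (Unreached? q) * (- χ x q)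

    tiedSum unreachedSum : Subset n → ℤ
    tiedSum x = sumℤ (λ p → sumℤ (λ q → tiedTerm p q x))
    unreachedSum x = sumℤ (λ q → unreachedTerm q x)

    tiedNormal unreachedNormal normal : Fin n → ℤ
    tiedNormal r      = sumℤ (λ p → sumℤ (λ q → 𝟙 (Tied? p q) * (δ p r - δ q r)))
    unreachedNormal r = sumℤ (λ q → 𝟙 (Unreached? q) * (- δ q r))
    normal r          = tiedNormal r + unreachedNormal r

    dot-tiedNormal : ∀ x → dot tiedNormal x ≡ tiedSum x
    dot-tiedNormal x = begin
      dot tiedNormal x
        ≡⟨ dot-sumℤ (λ p r → sumℤ (λ q → 𝟙 (Tied? p q) * (δ p r - δ q r))) x ⟩
      sumℤ (λ p → dot (λ r → sumℤ (λ q → 𝟙 (Tied? p q) * (δ p r - δ q r))) x)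
        ≡⟨ sumℤ-cong (λ p → dot-combination (𝟙 ∘ Tied? p) (λ q r → δ p r - δ q r) x) ⟩
      sumℤ (λ p → sumℤ (λ q → 𝟙 (Tied? p q) * dot (λ r → δ p r - δ q r) x))
        ≡⟨ sumℤ-cong (λ p → sumℤ-cong (λ q → cong (𝟙 (Tied? p q) *_) (dot-δ-δ p q x))) ⟩
      tiedSum x ∎

    dot-unreachedNormal : ∀ x → dot unreachedNormal x ≡ unreachedSum x
    dot-unreachedNormal x = trans (dot-combination (𝟙 ∘ Unreached?) (λ q r → - δ q r) x)
                                  (sumℤ-cong (λ q → cong (𝟙 (Unreached? q) *_) (dot-neg-δ q x)))

    dot-normal : ∀ x → dot normal x ≡ tiedSum x + unreachedSum x
    dot-normal x = trans (dot-+ tiedNormal unreachedNormal x) (cong₂ _+_ (dot-tiedNormal x) (dot-unreachedNormal x))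

    tiedTerm-nonpos : ∀ {x} → IsUpSet {_≼_ = _≼_} x → ∀ p q → tiedTerm p q x ≤ 0ℤ
    tiedTerm-nonpos {x} up p q = 𝟙*-nonpos (Tied? p q) λ (p≼q , _) →
      b2z-sub-nonpos (lookup x p) (lookup x q) (λ xp → []=⇒lookup (up p≼q (lookup⇒[]= p x xp)))

    unreachedTerm-nonpos : ∀ x q → unreachedTerm q x ≤ 0ℤ
    unreachedTerm-nonpos x q = 𝟙*-nonpos (Unreached? q) λ _ → neg-b2z-nonpos (lookup x q)

    tiedSum-nonpos : ∀ {x} → IsUpSet {_≼_ = _≼_} x → tiedSum x ≤ 0ℤ
    tiedSum-nonpos up = sumℤ-nonpos λ p → sumℤ-nonpos (tiedTerm-nonpos up p)

    unreachedSum-nonpos : ∀ x → unreachedSum x ≤ 0ℤ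
    unreachedSum-nonpos x = sumℤ-nonpos (unreachedTerm-nonpos x)

    normal-≡0⁻ : ∀ {x} → IsUpSet {_≼_ = _≼_} x → tiedSum x + unreachedSum x ≡ 0ℤ →
                 (∀ {p q} → Tied p q → q ∈ x → p ∈ x) × (∀ {q} → Unreached q → q ∉ x)
    normal-≡0⁻ {x} up on-face = tied , unreached
      where
      sums≡0 = ≤-+-tight (tiedSum-nonpos up) (unreachedSum-nonpos x) on-face
      tiedTerm≡0 : ∀ p q → tiedTerm p q x ≡ 0ℤ
      tiedTerm≡0 p = sumℤ-nonpos-≡0 (tiedTerm-nonpos up p)
                       (sumℤ-nonpos-≡0 (λ p → sumℤ-nonpos (tiedTerm-nonpos up p)) (proj₁ sums≡0) p)
      unreachedTerm≡0 : ∀ q → unreachedTerm q x ≡ 0ℤ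
      unreachedTerm≡0 = sumℤ-nonpos-≡0 (unreachedTerm-nonpos x) (proj₂ sums≡0)
      tied : ∀ {p q} → Tied p q → q ∈ x → p ∈ x
      tied {p} {q} t q∈x = lookup⇒[]= p x
        (b2z-sub-≡0⁻ (lookup x p) (lookup x q) (𝟙*-≡0⁻ (Tied? p q) (tiedTerm≡0 p q) t) ([]=⇒lookup q∈x))
      unreached : ∀ {q} → Unreached q → q ∉ x
      unreached {q} u q∈x =
        neg-b2z-≡0⁻ (lookup x q) (𝟙*-≡0⁻ (Unreached? q) (unreachedTerm≡0 q) u) ([]=⇒lookup q∈x)

    normal-≡0⁺ : ∀ {x} → (∀ {p q} → Tied p q → (p ∈ x → q ∈ x) × (q ∈ x → p ∈ x)) →
                 (∀ {q} → Unreached q → q ∉ x) → tiedSum x + unreachedSum x ≡ 0ℤ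
    normal-≡0⁺ {x} tied unreached = cong₂ _+_
      (sumℤ-zero λ p → sumℤ-zero λ q → 𝟙*-≡0⁺ (Tied? p q) λ t →
        b2z-sub-≡0⁺ (lookup x p) (lookup x q) (λ xp → []=⇒lookup (proj₁ (tied t) (lookup⇒[]= p x xp)))
                                               (λ xq → []=⇒lookup (proj₂ (tied t) (lookup⇒[]= q x xq))))
      (sumℤ-zero λ q → 𝟙*-≡0⁺ (Unreached? q) λ u → cong -_ (χ-∉ (unreached u)))

    ↑-on-face : ∀ i → tiedSum (↑ (e i)) + unreachedSum (↑ (e i)) ≡ 0ℤ
    ↑-on-face i with shape i
    ... | inj₁ ei≡⊥ = normal-≡0⁺ (λ _ → ⊥-elim ∘ ∉↑ei , ⊥-elim ∘ ∉↑ei) (λ _ → ∉↑ei)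
      where
      ∉↑ei : ∀ {q} → q ∉ ↑ (e i)
      ∉↑ei q∈ = ∉⊥ (subst (_ ∈_) (trans (cong ↑ ei≡⊥) ↑⊥) q∈)
    ... | inj₂ (c , ei≡⁅c⁆) = normal-≡0⁺
      (λ (p≼q , below) → (λ p∈ → ∈⁺ (≼.trans (∈⁻ p∈) p≼q)) ,
                         (λ q∈ → ∈⁺ (below c (i , ei≡⁅c⁆) (∈⁻ q∈))))
      (λ unreached q∈ → unreached c (i , ei≡⁅c⁆) (∈⁻ q∈))
      where
      ∈⁻ : ∀ {q} → q ∈ ↑ (e i) → c ≼ q
      ∈⁻ {q} q∈ = ∈↑⁅⁆⁻ (subst (q ∈_) (cong ↑ ei≡⁅c⁆) q∈)
      ∈⁺ : ∀ {q} → c ≼ q → q ∈ ↑ (e i)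
      ∈⁺ {q} c≼q = subst (q ∈_) (cong ↑ (sym ei≡⁅c⁆)) (∈↑⁅⁆⁺ c≼q)

    reached : ∀ {v} → IsUpSet {_≼_ = _≼_} v → tiedSum v + unreachedSum v ≡ 0ℤ →
              ∀ {q} → q ∈ v → ∃ λ c → InChain c × c ≼ q × c ∈ v
    reached up on-face {q} q∈v with any? (λ c → InChain? c ×-dec (c ≼? q))
    ... | no none = ⊥-elim (proj₂ (normal-≡0⁻ up on-face) (λ c c∈ c≼q → none (c , c∈ , c≼q)) q∈v)
    ... | yes below-q
      with greatest _≼_ (λ c → InChain? c ×-dec (c ≼? q)) (λ (c∈ , _) (d∈ , _) → chain c∈ d∈) ≼.trans below-q
    ... | c , (c∈ , c≼q) , largest =
      c , c∈ , c≼q , proj₁ (normal-≡0⁻ up on-face) (c≼q , λ d d∈ d≼q → largest d (d∈ , d≼q)) q∈v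

    ↑-exposed : ∀ {v} → IsUpSet {_≼_ = _≼_} v → tiedSum v + unreachedSum v ≡ 0ℤ → Image (↑ ∘ e) v
    ↑-exposed {v} up on-face with nonempty? v
    ... | no empty = let (i , ei≡⊥) = ∋⊥ in i , trans (cong ↑ ei≡⊥) (trans ↑⊥ (sym (Empty-unique empty)))
    ... | yes (q , q∈v)
      with greatest (λ c d → d ≼ c) (λ c → InChain? c ×-dec (c ∈? v))
                    (λ (c∈ , _) (d∈ , _) → Sum.swap (chain c∈ d∈)) (λ d≼c l≼d → ≼.trans l≼d d≼c)
                    (let (c , c∈ , _ , c∈v) = reached up on-face q∈v in c , c∈ , c∈v)
    ... | c , ((i , ei≡⁅c⁆) , c∈v) , least = i , trans (cong ↑ ei≡⁅c⁆) (⊆-antisym ↑c⊆v v⊆↑c)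
      where
      ↑c⊆v : ↑ ⁅ c ⁆ ⊆ v
      ↑c⊆v r∈ = up (∈↑⁅⁆⁻ r∈) c∈v
      v⊆↑c : v ⊆ ↑ ⁅ c ⁆
      v⊆↑c r∈v = let (d , d∈ , d≼r , d∈v) = reached up on-face r∈v in
                 ∈↑⁅⁆⁺ (≼.trans (least d (d∈ , d∈v)) d≼r)

    IsFaceEnum-↑ : IsFaceEnum (OrderVertex _≼_) (↑ ∘ e)
    IsFaceEnum-↑ =
      (λ i → IsUpSet⇒OrderVertex (↑-IsUpSet (e i))) ,
      (λ i j ↑ei≡↑ej → e-injective i j (↑-injective (shape i) (shape j) ↑ei≡↑ej)) ,
      normal , 0ℤ ,
      (λ v ov → subst (_≤ 0ℤ) (sym (dot-normal v))
                      (ℤP.+-mono-≤ (tiedSum-nonpos {x = v} (OrderVertex⇒IsUpSet ov)) (unreachedSum-nonpos v))) ,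
      (λ i → trans (dot-normal (↑ (e i))) (↑-on-face i)) ,
      (λ v ov normal·v≡0 → ↑-exposed (OrderVertex⇒IsUpSet ov) (trans (sym (dot-normal v)) normal·v≡0))

  ↑-simplex : SimplexFace⁰ (ChainVertex _≼_) k → SimplexFace⁰ (OrderVertex _≼_) k
  ↑-simplex (e , face , ind , (i , ei≡⊥)) =
    ↑ ∘ e , IsFaceEnum-↑ , AffInd-↑ vertex-shape injective , (i , trans (cong ↑ ei≡⊥) ↑⊥)
    where
    open Face face using (injective)
    open ChainSimplex po face ind (i , ei≡⊥)
    open ChainImage vertex-shape injective (i , ei≡⊥) (singletons-comparable _≼?_)

  ↑-simplex-reflects : (F G : SimplexFace⁰ (ChainVertex _≼_) k) → SameFace (↑-simplex F) (↑-simplex G) → SameFace F G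
  ↑-simplex-reflects (e , face , ind , ∋⊥) (e′ , face′ , ind′ , ∋⊥′) =
    SameImage-∘⁻ ↑ (λ i j → ↑-injective (ChainSimplex.vertex-shape po face ind ∋⊥ i)
                                        (ChainSimplex.vertex-shape po face′ ind′ ∋⊥′ j))


-- The three coefficientwise inequalities

¬¬-∀Fin : {P : Fin m → Set} → (∀ i → ¬ ¬ P i) → ¬ ¬ (∀ i → P i)
¬¬-∀Fin {zero}  _   = pure λ ()
¬¬-∀Fin {suc m} ¬¬P = do
  P0   ← ¬¬P zero
  Psuc ← ¬¬-∀Fin (¬¬P ∘ suc)
  pure λ { zero → P0 ; (suc i) → Psuc i }

¬¬-decidable : (R : Fin n → Fin n → Set) → ¬ ¬ (∀ p q → Dec (R p q))
¬¬-decidable R = ¬¬-∀Fin λ p → ¬¬-∀Fin λ q → ¬¬-excluded-middle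

module _ {_≼_ : Fin n → Fin n → Set} (po : IsPartialOrder _≡_ _≼_) where

  CoeffS⁰-chain≤order : ∀ {a b} → CoeffS⁰ (ChainVertex _≼_) k a → CoeffS⁰ (OrderVertex _≼_) k b → a ℕ.≤ b
  CoeffS⁰-chain≤order {a = a} {b} Ca Cb = decidable-stable (a ℕ.≤? b) do
    _≼?_ ← ¬¬-decidable _≼_
    pure (NumFaces-injective⇒≤ Ca Cb (↑-simplex po _≼?_) (↑-simplex-reflects po _≼?_))
    where open UpClosure

  CoeffS¹-order≤chain : (∀ m m′ → CoeffS (OrderVertex _≼_) k m → CoeffS (ChainVertex _≼_) k m′ → + m ≤ + m′) →
                        ∀ {g d} → CoeffS¹ (OrderVertex _≼_) k g → CoeffS¹ (ChainVertex _≼_) k d → g ℕ.≤ d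
  CoeffS¹-order≤chain S-O≤S-C {g} {d} Cg Cd = decidable-stable (g ℕ.≤? d) do
    (a , Ca) ← NumFaces-exists
    (b , Cb) ← NumFaces-exists
    let b+g≤a+d = ℤP.drop‿+≤+ (S-O≤S-C (b ℕ.+ g) (a ℕ.+ d) (CoeffS-split Cb Cg) (CoeffS-split Ca Cd))
    pure (ℕP.+-cancelˡ-≤ b g d (ℕP.≤-trans b+g≤a+d (ℕP.+-monoˡ-≤ d (CoeffS⁰-chain≤order Ca Cb))))

b-a≤d-g : ∀ a b g d → + (b ℕ.+ g) ≤ + (a ℕ.+ d) → + b - + a ≤ + d - + g
b-a≤d-g a b g d b+g≤a+d = subst₂ _≤_ (cancelʳ (+ b) (+ g) (+ a)) (cancelˡ (+ a) (+ d) (+ g))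
  (ℤP.+-monoˡ-≤ (- + a - + g) (subst₂ _≤_ (ℤP.pos-+ b g) (ℤP.pos-+ a d) b+g≤a+d))
  where
  cancelʳ : ∀ x y z → (x + y) + (- z - y) ≡ x - z
  cancelʳ = solve-∀
  cancelˡ : ∀ x y z → (x + y) + (- x - z) ≡ y - z
  cancelˡ = solve-∀

lemma3p10 : (n : ℕ) (_≼_ : Fin n → Fin n → Set) → IsPartialOrder _≡_ _≼_ →
    -- hypothesis S_O(P)(x) ≤ S_C(P)(x) coefficientwise
    (∀ k m m′ → CoeffS (OrderVertex _≼_) k m → CoeffS (ChainVertex _≼_) k m′ →
      + m ≤ + m′) →
    -- (1): coefficient of x^k: a = [x^k] S⁰_C = [x^k] x·α̃, b = [x^k] x·β̃,
    --      g = [x^k] γ̃, d = [x^k] δ̃ ;  0 ≤ b - a ≤ d - g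
    (∀ k a b g d →
      CoeffS⁰ (ChainVertex _≼_) k a → CoeffS⁰ (OrderVertex _≼_) k b →
      CoeffS¹ (OrderVertex _≼_) k g → CoeffS¹ (ChainVertex _≼_) k d →
      (+ 0 ≤ + b - + a) × (+ b - + a ≤ + d - + g)) ×
    -- (2): coefficient of x^k: [x^k] α̃ = [x^(k+1)] S⁰_C, etc.
    (∀ k a b g d →
      CoeffS⁰ (ChainVertex _≼_) (suc k) a → CoeffS⁰ (OrderVertex _≼_) (suc k) b →
      CoeffS¹ (OrderVertex _≼_) k g → CoeffS¹ (ChainVertex _≼_) k d →
      (+ 0 ≤ + a) × (+ a ≤ + b) × (+ b ≤ + g) × (+ g ≤ + d))
lemma3p10 n _≼_ po S-O≤S-C =
  (λ k a b g d Ca Cb Cg Cd →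
     ℤP.i≤j⇒0≤j-i (+≤+ (CoeffS⁰-chain≤order po Ca Cb)) ,
     b-a≤d-g a b g d (S-O≤S-C k (b ℕ.+ g) (a ℕ.+ d) (CoeffS-split Cb Cg) (CoeffS-split Ca Cd))) ,
  (λ k a b g d Ca Cb Cg Cd →
     +≤+ z≤n ,
     +≤+ (CoeffS⁰-chain≤order po Ca Cb) ,
     +≤+ (LatticeClosed.CoeffS⁰-suc≤CoeffS¹ OrderVertex-∪ OrderVertex-∩ Cb Cg) ,
     +≤+ (CoeffS¹-order≤chain po (S-O≤S-C k) Cg Cd))
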